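{- If $G$ has girth at least five, then the iterated edge-biclique operator applied to $G$ converges towards the graph induced by the union of all the cycles and the paths connecting cycles of $G$.
   Context: All graphs are finite, simple and undirected. The girth of $G$ is the length of a shortest cycle of $G$ (acyclic graphs have infinite girth). A biclique of a graph $G$ is a maximal induced complete bipartite subgraph of $G$. The edge-biclique graph $KB_e(G)$ has one vertex for each biclique of $G$, two vertices being adjacent when the corresponding bicliques share at least one edge. Iterates: $KB_e^0(G)=G$, $KB_e^k(G)=KB_e(KB_e^{k-1}(G))$. $G$ converges under $KB_e$ towards $H$ if $KB_e^k(G)\cong H$ for all sufficiently large $k$; the empty graph is allowed as a limit. -}

module Defs where

open import Data.Nat using (ℕ; zero; suc; _≤_; _+_)
open import Data.Bool using (Bool; true; false; _xor_; if_then_else_)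
import Data.Bool.Properties as BoolP
open import Data.Fin using (Fin; zero; suc; inject₁; fromℕ)
open import Data.Fin.Properties using (all?; any?) renaming (_≟_ to _≟ᶠ_)
open import Data.Fin.Subset using (Subset; _∈_; _∉_; _⊆_; Nonempty; outside; inside)
open import Data.Fin.Subset.Properties using (_∈?_; _⊆?_; nonempty?; anySubset?)
open import Data.Vec using (Vec; []; _∷_)
import Data.Vec as Vec
open import Data.List using (List; []; _∷_; filter; length; map; _++_)
import Data.List as List
open import Data.Product using (Σ; ∃; ∃-syntax; _×_; _,_; proj₁; proj₂)
open import Data.Empty using (⊥; ⊥-elim)
open import Function using (_∘_; _⇔_; mk⇔)
open import Function.Definitions using (Injective)
open import Relation.Nullary using (Dec; yes; no; ¬_)
open import Relation.Nullary.Decidable using (⌊_⌋; _×-dec_; _→-dec_; decidable-stable; map′)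
open import Relation.Binary.PropositionalEquality using (_≡_; refl; sym; trans)

record Graph : Set where
  field
    size  : ℕ
    adj   : Fin size → Fin size → Bool
    adj-sym   : ∀ u v → adj u v ≡ adj v u
    adj-irrefl : ∀ u → adj u u ≡ false
open Graph public

-- S induces a complete bipartite graph K_{p,q} (p, q ≥ 1): there is a
-- bipartition S = X ∪ (S ∖ X), both parts nonempty, such that two vertices
-- of S are adjacent iff they lie in different parts.
InducesCompleteBipartite : (G : Graph) → Subset (size G) → Set
InducesCompleteBipartite G S =
  ∃[ X ] (X ⊆ S × Nonempty X × (∃[ v ] (v ∈ S × v ∉ X)) ×
          (∀ u v → u ∈ S → v ∈ S → adj G u v ≡ (Vec.lookup X u xor Vec.lookup X v)))

IsBiclique : (G : Graph) → Subset (size G) → Set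
IsBiclique G S = InducesCompleteBipartite G S ×
  (∀ T → S ⊆ T → InducesCompleteBipartite G T → T ⊆ S)

allSubset? : ∀ {n} {P : Subset n → Set} → (∀ S → Dec (P S)) → Dec (∀ S → P S)
allSubset? {P = P} P? with anySubset? (λ S → Relation.Nullary.Decidable.¬? (P? S))
  where import Relation.Nullary.Decidable
... | yes (S , ¬p) = no (λ h → ¬p (h S))
... | no h = yes (λ S → decidable-stable (P? S) (λ ¬p → h (S , ¬p)))

≡? : (a b : Bool) → Dec (a ≡ b)
≡? = BoolP._≟_

icb? : (G : Graph) → ∀ S → Dec (InducesCompleteBipartite G S)
icb? G S = anySubset? (λ X → (X ⊆? S) ×-dec nonempty? X ×-dec
  any? (λ v → (v ∈? S) ×-dec Relation.Nullary.Decidable.¬? (v ∈? X)) ×-dec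
  all? (λ u → all? (λ v → (u ∈? S) →-dec ((v ∈? S) →-dec
     ≡? (adj G u v) (Vec.lookup X u xor Vec.lookup X v)))))
  where import Relation.Nullary.Decidable

biclique? : (G : Graph) → ∀ S → Dec (IsBiclique G S)
biclique? G S = icb? G S ×-dec allSubset? (λ T → (S ⊆? T) →-dec (icb? G T →-dec (T ⊆? S)))

subsets : (n : ℕ) → List (Subset n)
subsets zero = [] ∷ []
subsets (suc n) = map (outside ∷_) (subsets n) ++ map (inside ∷_) (subsets n)

bicliques : (G : Graph) → List (Subset (size G))
bicliques G = filter (biclique? G) (subsets (size G))

-- Two bicliques share an edge of G (edges of a biclique = edges of G with
-- both ends in it, as bicliques are induced).
ShareEdge : (G : Graph) → Subset (size G) → Subset (size G) → Set
ShareEdge G B C = ∃[ u ] ∃[ v ] (u ∈ B × u ∈ C × v ∈ B × v ∈ C × adj G u v ≡ true)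

shareEdge? : (G : Graph) → ∀ B C → Dec (ShareEdge G B C)
shareEdge? G B C = any? (λ u → any? (λ v → (u ∈? B) ×-dec (u ∈? C) ×-dec
  (v ∈? B) ×-dec (v ∈? C) ×-dec ≡? (adj G u v) true))

private
  dec-same : ∀ {A B : Set} (a : Dec A) (b : Dec B) → (A → B) → (B → A) → ⌊ a ⌋ ≡ ⌊ b ⌋
  dec-same (yes _) (yes _) f g = refl
  dec-same (yes a) (no ¬b) f g = ⊥-elim (¬b (f a))
  dec-same (no ¬a) (yes b) f g = ⊥-elim (¬a (g b))
  dec-same (no _) (no _) f g = refl

  share-swap : ∀ G B C → ShareEdge G B C → ShareEdge G C B
  share-swap G B C (u , v , uB , uC , vB , vC , e) = u , v , uC , uB , vC , vB , e

  kbAdj : (G : Graph) → Fin (length (bicliques G)) → Fin (length (bicliques G)) → Bool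
  kbAdj G i j = if ⌊ i ≟ᶠ j ⌋ then false else
    ⌊ shareEdge? G (List.lookup (bicliques G) i) (List.lookup (bicliques G) j) ⌋

  kbSym : ∀ G i j → kbAdj G i j ≡ kbAdj G j i
  kbSym G i j with i ≟ᶠ j | j ≟ᶠ i
  ... | yes _ | yes _ = refl
  ... | yes p | no ¬q = ⊥-elim (¬q (sym p))
  ... | no ¬p | yes q = ⊥-elim (¬p (sym q))
  ... | no _ | no _ = dec-same (shareEdge? G _ _) (shareEdge? G _ _)
                        (share-swap G _ _) (share-swap G _ _)

  kbIrr : ∀ G i → kbAdj G i i ≡ false
  kbIrr G i with i ≟ᶠ i
  ... | yes _ = refl
  ... | no ¬p = ⊥-elim (¬p refl)

KBe : Graph → Graph
KBe G = record
  { size = length (bicliques G)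
  ; adj = kbAdj G
  ; adj-sym = kbSym G
  ; adj-irrefl = kbIrr G }

KBe^ : ℕ → Graph → Graph
KBe^ zero G = G
KBe^ (suc k) G = KBe (KBe^ k G)

-- A cycle of length 3 + j: distinct vertices c 0, …, c (2+j) with
-- consecutive ones adjacent and c (2+j) adjacent to c 0.
record Cycle (G : Graph) (j : ℕ) : Set where
  field
    vert     : Fin (3 + j) → Fin (size G)
    distinct : Injective _≡_ _≡_ vert
    step     : ∀ (i : Fin (2 + j)) → adj G (vert (inject₁ i)) (vert (suc i)) ≡ true
    close    : adj G (vert (fromℕ (2 + j))) (vert zero) ≡ true
open Cycle public

record Path (G : Graph) (ℓ : ℕ) : Set where
  field
    pvert     : Fin (suc ℓ) → Fin (size G)
    pdistinct : Injective _≡_ _≡_ pvert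
    pstep     : ∀ (i : Fin ℓ) → adj G (pvert (inject₁ i)) (pvert (suc i)) ≡ true
open Path public

GirthAtLeast5 : Graph → Set
GirthAtLeast5 G = ∀ j → Cycle G j → 5 ≤ 3 + j

OnCycle : (G : Graph) → Fin (size G) → Set
OnCycle G v = ∃[ j ] Σ (Cycle G j) (λ c → ∃[ i ] vert c i ≡ v)

-- v belongs to the union of all cycles and all paths connecting cycles:
-- v lies on a path (possibly of length 0) both of whose endpoints lie on
-- cycles.  (Length-0 paths cover the vertices of cycles themselves.)
InCyclesAndConnectingPaths : (G : Graph) → Fin (size G) → Set
InCyclesAndConnectingPaths G v = ∃[ ℓ ] Σ (Path G ℓ) (λ p →
  OnCycle G (pvert p zero) × OnCycle G (pvert p (fromℕ ℓ)) × ∃[ i ] pvert p i ≡ v)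

IsoToInduced : (H G : Graph) → (Fin (size G) → Set) → Set
IsoToInduced H G C = Σ (Fin (size H) → Fin (size G)) λ f →
  Injective _≡_ _≡_ f ×
  (∀ u v → adj H u v ≡ adj G (f u) (f v)) ×
  (∀ w → C w ⇔ (∃[ u ] f u ≡ w))

ConvergesToInduced : (G : Graph) → (Fin (size G) → Set) → Set
ConvergesToInduced G C = ∃[ k₀ ] (∀ k → k₀ ≤ k → IsoToInduced (KBe^ k G) G C)

{-# OPTIONS --safe #-}
module Submission where

-- In a graph of girth at least five every biclique is the closed neighbourhood N[c] of a
-- vertex c having a neighbour, N[c] is a biclique as soon as c has two neighbours, and two
-- such bicliques share an edge iff their centres are adjacent.  So the centres embed KB_e(H)
-- as an induced subgraph of H whose image contains every vertex of degree at least two.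
-- Along the iterates the vertex counts decrease until the embedding is a bijection; from then
-- on every vertex has degree at least two, and such a graph is the union of its cycles and
-- connecting paths.  Conversely each vertex of that union has two neighbours in it, so it
-- survives in every iterate.

open import Defs
open import Data.Nat as ℕ using (ℕ; zero; suc; _+_; _≤_; _<_; _≤′_; ≤′-refl; ≤′-step)
import Data.Nat.Properties as ℕ
open import Data.Bool using (Bool; true; false; _xor_; if_then_else_)
import Data.Bool.Properties as Bool
open import Data.Fin as Fin using (Fin; zero; suc; inject₁; inject≤; fromℕ; toℕ; opposite; punchOut)
import Data.Fin.Properties as Fin
open import Data.Fin.Relation.Unary.Top using (view; ‵fromℕ; ‵inject₁)
open import Data.Fin.Subset using (Subset; _∈_; _∉_; _⊆_; ⁅_⁆; _∪_; inside; outside)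
import Data.Fin.Subset.Properties as Subset
open import Data.Fin.Subset.Properties using (_∈?_)
import Data.Vec as Vec
import Data.Vec.Properties as Vec
open import Data.List as List using (List)
import Data.List.Membership.Propositional as List
import Data.List.Membership.Propositional.Properties as List
import Data.List.Relation.Unary.All as All
import Data.List.Relation.Unary.AllPairs as AllPairs
import Data.List.Relation.Unary.Any as Any
import Data.List.Relation.Unary.Any.Properties as Any
open import Data.List.Relation.Unary.Unique.Propositional using (Unique)
import Data.List.Relation.Unary.Unique.Propositional.Properties as Unique
open import Data.Product using (∃; _×_; _,_; proj₁; proj₂)
open import Data.Sum using (_⊎_; inj₁; inj₂)
open import Data.Unit using (⊤; tt)
open import Data.Empty using (⊥; ⊥-elim)
open import Function using (_∘_; id; _⇔_; mk⇔; Equivalence)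
open import Function.Definitions using (Injective)
open import Relation.Nullary using (Dec; yes; no; ¬_; contradiction)
open import Relation.Nullary.Decidable using (⌊_⌋; _×-dec_; ¬?; map′; decidable-stable)
open import Relation.Binary.PropositionalEquality

Adjacent : (G : Graph) → Fin (size G) → Fin (size G) → Set
Adjacent G u v = adj G u v ≡ true

adjacent-sym : (G : Graph) {u v : Fin (size G)} → Adjacent G u v → Adjacent G v u
adjacent-sym G {u} {v} u∼v = trans (adj-sym G v u) u∼v

adjacent⇒≢ : (G : Graph) {u v : Fin (size G)} → Adjacent G u v → u ≢ v
adjacent⇒≢ G {u} u∼u refl = contradiction (trans (sym u∼u) (adj-irrefl G u)) λ ()

record TwoNeighboursIn (G : Graph) (Q : Fin (size G) → Set) (u : Fin (size G)) : Set where
  constructor twoNeighbours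
  field
    x y : Fin (size G)
    x≢y : x ≢ y
    u∼x : Adjacent G u x
    u∼y : Adjacent G u y
    Qx : Q x
    Qy : Q y

TwoNeighbours : (G : Graph) → Fin (size G) → Set
TwoNeighbours G = TwoNeighboursIn G (λ _ → ⊤)

MinDegree≥2 : Graph → Set
MinDegree≥2 G = ∀ u → TwoNeighbours G u

mapTwoNeighbours : ∀ {G Q R u} → (∀ {w} → Q w → R w) → TwoNeighboursIn G Q u → TwoNeighboursIn G R u
mapTwoNeighbours f (twoNeighbours x y x≢y u∼x u∼y Qx Qy) =
  twoNeighbours x y x≢y u∼x u∼y (f Qx) (f Qy)

twoNeighbours? : (G : Graph) → ∀ u → Dec (TwoNeighbours G u)
twoNeighbours? G u = map′
  (λ (x , y , x≢y , u∼x , u∼y) → twoNeighbours x y x≢y u∼x u∼y tt tt)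
  (λ (twoNeighbours x y x≢y u∼x u∼y _ _) → x , y , x≢y , u∼x , u∼y)
  (Fin.any? λ x → Fin.any? λ y →
    ¬? (x Fin.≟ y) ×-dec (adj G u x Bool.≟ true) ×-dec (adj G u y Bool.≟ true))

-- Induced embeddings

record Embedding (H G : Graph) : Set where
  field
    to        : Fin (size H) → Fin (size G)
    injective : Injective _≡_ _≡_ to
    adj-to    : ∀ u v → adj H u v ≡ adj G (to u) (to v)

  Covers : Fin (size G) → Set
  Covers w = ∃ λ u → to u ≡ w

  cycle : ∀ {j} → Cycle H j → Cycle G j
  cycle c = record
    { vert = to ∘ vert c ; distinct = distinct c ∘ injective
    ; step = λ i → trans (sym (adj-to _ _)) (step c i)
    ; close = trans (sym (adj-to _ _)) (close c) }

  path : ∀ {ℓ} → Path H ℓ → Path G ℓ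
  path p = record
    { pvert = to ∘ pvert p ; pdistinct = pdistinct p ∘ injective
    ; pstep = λ i → trans (sym (adj-to _ _)) (pstep p i) }

  onCycle : ∀ {u} → OnCycle H u → OnCycle G (to u)
  onCycle (j , c , i , refl) = j , cycle c , i , refl

  inCore : ∀ {u} → InCyclesAndConnectingPaths H u → InCyclesAndConnectingPaths G (to u)
  inCore (ℓ , p , start , end , i , refl) = ℓ , path p , onCycle start , onCycle end , i , refl

  girth≥5 : GirthAtLeast5 G → GirthAtLeast5 H
  girth≥5 girthG j c = girthG j (cycle c)

  twoNeighbours-reflect : ∀ {Q u} → (∀ {w} → Q w → Covers w) →
    TwoNeighboursIn G Q (to u) → TwoNeighbours H u
  twoNeighbours-reflect {u = u} covers (twoNeighbours x y x≢y u∼x u∼y Qx Qy)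
    with covers Qx | covers Qy
  ... | x′ , refl | y′ , refl =
    twoNeighbours x′ y′ (x≢y ∘ cong to) (trans (adj-to u x′) u∼x) (trans (adj-to u y′) u∼y) tt tt

open Embedding using (to; Covers)

idₑ : (G : Graph) → Embedding G G
idₑ G = record { to = id ; injective = id ; adj-to = λ _ _ → refl }

_∘ₑ_ : ∀ {A B C} → Embedding B C → Embedding A B → Embedding A C
g ∘ₑ f = record
  { to = to g ∘ to f
  ; injective = Embedding.injective f ∘ Embedding.injective g
  ; adj-to = λ u v → trans (Embedding.adj-to f u v) (Embedding.adj-to g _ _) }

-- The core of a graph: the vertices satisfying InCyclesAndConnectingPaths

module _ {G : Graph} where

  OnPath : ∀ {ℓ} → Path G ℓ → Fin (size G) → Set
  OnPath p w = ∃ λ i → pvert p i ≡ w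

  start end : ∀ {ℓ} → Path G ℓ → Fin (size G)
  start p = pvert p zero
  end {ℓ} p = pvert p (fromℕ ℓ)

  trivialPath : Fin (size G) → Path G 0
  trivialPath w = record
    { pvert = λ _ → w ; pdistinct = λ { {zero} {zero} _ → refl } ; pstep = λ () }

  cycle⇒path : ∀ {j} → Cycle G j → Path G (2 + j)
  cycle⇒path c = record { pvert = vert c ; pdistinct = distinct c ; pstep = step c }

  onCycle⇒inCore : ∀ {w} → OnCycle G w → InCyclesAndConnectingPaths G w
  onCycle⇒inCore {w} onCycle = 0 , trivialPath w , onCycle , onCycle , zero , refl

  private
    inject₁²≢suc² : ∀ {n} (k : Fin n) → inject₁ (inject₁ k) ≢ suc (suc k)
    inject₁²≢suc² zero ()
    inject₁²≢suc² (suc k) eq = inject₁²≢suc² k (Fin.suc-injective eq)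

  interior-twoNeighbours : ∀ {ℓ} (p : Path G (suc ℓ)) (k : Fin ℓ) →
    TwoNeighboursIn G (OnPath p) (pvert p (suc (inject₁ k)))
  interior-twoNeighbours p k = twoNeighbours _ _
    (inject₁²≢suc² k ∘ pdistinct p)
    (adjacent-sym G (pstep p (inject₁ k))) (pstep p (suc k))
    (_ , refl) (_ , refl)

  cycle-twoNeighbours : ∀ {j} (c : Cycle G j) i → TwoNeighboursIn G (OnCycle G) (vert c i)
  cycle-twoNeighbours {j} c zero = twoNeighbours _ _
    ((λ ()) ∘ distinct c) (step c zero) (adjacent-sym G (close c))
    (j , c , _ , refl) (j , c , _ , refl)
  cycle-twoNeighbours {j} c (suc i) with view i
  ... | ‵fromℕ = twoNeighbours _ _
    ((λ ()) ∘ distinct c) (adjacent-sym G (step c (fromℕ (suc j)))) (close c)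
    (j , c , _ , refl) (j , c , zero , refl)
  ... | ‵inject₁ k = mapTwoNeighbours (λ (i , eq) → j , c , i , eq)
    (interior-twoNeighbours (cycle⇒path c) k)

  onCycle-twoNeighbours : ∀ {w} → OnCycle G w → TwoNeighboursIn G (OnCycle G) w
  onCycle-twoNeighbours (_ , c , i , refl) = cycle-twoNeighbours c i

  inCore-twoNeighbours : ∀ {w} → InCyclesAndConnectingPaths G w →
    TwoNeighboursIn G (InCyclesAndConnectingPaths G) w
  inCore-twoNeighbours (ℓ , p , onCycleˢ , onCycleᵉ , i , refl) with view i
  ... | ‵fromℕ = mapTwoNeighbours onCycle⇒inCore (onCycle-twoNeighbours onCycleᵉ)
  ... | ‵inject₁ zero = mapTwoNeighbours onCycle⇒inCore (onCycle-twoNeighbours onCycleˢ)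
  ... | ‵inject₁ (suc k) = mapTwoNeighbours (λ (i , eq) → ℓ , p , onCycleˢ , onCycleᵉ , i , eq)
    (interior-twoNeighbours p k)

-- Minimum degree two forces every vertex into the core

module _ {G : Graph} where

  path-length< : ∀ {ℓ} → Path G ℓ → ℓ < size G
  path-length< p = Fin.injective⇒≤ (pdistinct p)

  StartSaturated : ∀ {ℓ} → Path G ℓ → Set
  StartSaturated p = ∀ w → Adjacent G (start p) w → OnPath p w

  prepend : ∀ {ℓ} (p : Path G ℓ) w → Adjacent G w (start p) → ¬ OnPath p w → Path G (suc ℓ)
  prepend {ℓ} p w w∼p w∉p = record { pvert = vertex ; pdistinct = distinct′ ; pstep = step′ }
    where
    vertex : Fin (2 + ℓ) → Fin (size G)
    vertex zero = w
    vertex (suc i) = pvert p i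
    distinct′ : Injective _≡_ _≡_ vertex
    distinct′ {zero} {zero} _ = refl
    distinct′ {zero} {suc j} eq = contradiction (j , sym eq) w∉p
    distinct′ {suc i} {zero} eq = contradiction (i , eq) w∉p
    distinct′ {suc i} {suc j} eq = cong suc (pdistinct p eq)
    step′ : ∀ (i : Fin (suc ℓ)) → Adjacent G (vertex (inject₁ i)) (vertex (suc i))
    step′ zero = w∼p
    step′ (suc i) = pstep p i

  record Saturation {ℓ} (p : Path G ℓ) : Set where
    field
      length    : ℕ
      path      : Path G length
      saturated : StartSaturated path
      ⊇         : ∀ {w} → OnPath p w → OnPath path w
      same-end  : end path ≡ end p

  private
    extendable? : ∀ {ℓ} (p : Path G ℓ) → Dec (∃ λ w → Adjacent G (start p) w × ¬ OnPath p w)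
    extendable? p = Fin.any? λ w → (adj G (start p) w Bool.≟ true) ×-dec
      ¬? (Fin.any? λ i → pvert p i Fin.≟ w)

    -- Every prepended vertex is new, so no more than size G ∸ (1 + ℓ) of them fit.
    saturate′ : ∀ fuel {ℓ} (p : Path G ℓ) → size G ≤ suc ℓ + fuel → Saturation p
    saturate′ fuel p size≤ with extendable? p
    saturate′ fuel p size≤ | no ¬ext = record
      { length = _ ; path = p ; ⊇ = id ; same-end = refl
      ; saturated = λ w p∼w → decidable-stable
          (Fin.any? λ i → pvert p i Fin.≟ w) (λ w∉p → ¬ext (w , p∼w , w∉p)) }
    saturate′ zero {ℓ} p size≤ | yes (w , p∼w , w∉p) = contradiction
      (ℕ.≤-trans (path-length< (prepend p w (adjacent-sym G p∼w) w∉p))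
        (subst (size G ≤_) (ℕ.+-identityʳ (suc ℓ)) size≤))
      ℕ.1+n≰n
    saturate′ (suc fuel) {ℓ} p size≤ | yes (w , p∼w , w∉p) = record
      { Saturation s ; ⊇ = λ (i , eq) → Saturation.⊇ s (suc i , eq) }
      where
      s : Saturation (prepend p w (adjacent-sym G p∼w) w∉p)
      s = saturate′ fuel (prepend p w (adjacent-sym G p∼w) w∉p)
        (subst (size G ≤_) (ℕ.+-suc (suc ℓ) fuel) size≤)

  saturate : ∀ {ℓ} (p : Path G ℓ) → Saturation p
  saturate {ℓ} p = saturate′ (size G) p (ℕ.m≤n+m (size G) (suc ℓ))

  private
    opposite-inject₁ : ∀ {m} (i : Fin m) → opposite (inject₁ i) ≡ suc (opposite i)
    opposite-inject₁ {suc m} zero = refl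
    opposite-inject₁ {suc m} (suc i) = cong inject₁ (opposite-inject₁ i)

    opposite-fromℕ : ∀ m → opposite (fromℕ m) ≡ zero
    opposite-fromℕ zero = refl
    opposite-fromℕ (suc m) = cong inject₁ (opposite-fromℕ m)

    opposite-injective : ∀ {m} → Injective _≡_ _≡_ (opposite {m})
    opposite-injective {_} {i} {j} eq =
      trans (sym (Fin.opposite-involutive i)) (trans (cong opposite eq) (Fin.opposite-involutive j))

  reverse : ∀ {ℓ} → Path G ℓ → Path G ℓ
  reverse p = record
    { pvert = pvert p ∘ opposite
    ; pdistinct = opposite-injective ∘ pdistinct p
    ; pstep = λ i → subst (λ k → Adjacent G (pvert p k) (pvert p (opposite (suc i))))
        (sym (opposite-inject₁ i)) (adjacent-sym G (pstep p (opposite i))) }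

  reverse-⊇ : ∀ {ℓ} (p : Path G ℓ) {w} → OnPath p w → OnPath (reverse p) w
  reverse-⊇ p (i , refl) = opposite i , cong (pvert p) (Fin.opposite-involutive i)

  end-reverse : ∀ {ℓ} (p : Path G ℓ) → end (reverse p) ≡ start p
  end-reverse {ℓ} p = cong (pvert p) (opposite-fromℕ ℓ)

  private
    inject≤-inject₁ : ∀ {m n} (k : Fin m) .(le : suc m ≤ suc n) .(le′ : m ≤ n) →
      inject≤ (inject₁ k) le ≡ inject₁ (inject≤ k le′)
    inject≤-inject₁ k le le′ = Fin.toℕ-injective (begin
      toℕ (inject≤ (inject₁ k) le) ≡⟨ Fin.toℕ-inject≤ (inject₁ k) le ⟩
      toℕ (inject₁ k)              ≡⟨ Fin.toℕ-inject₁ k ⟩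
      toℕ k                        ≡⟨ Fin.toℕ-inject≤ k le′ ⟨
      toℕ (inject≤ k le′)          ≡⟨ Fin.toℕ-inject₁ (inject≤ k le′) ⟨
      toℕ (inject₁ (inject≤ k le′)) ∎)
      where open ≡-Reasoning

    inject≤-fromℕ : ∀ {n} (i : Fin n) .(le : suc (toℕ i) ≤ n) → inject≤ (fromℕ (toℕ i)) le ≡ i
    inject≤-fromℕ i le = Fin.toℕ-injective
      (trans (Fin.toℕ-inject≤ (fromℕ (toℕ i)) le) (Fin.toℕ-fromℕ (toℕ i)))

  prefix : ∀ {ℓ} (p : Path G ℓ) (i : Fin (suc ℓ)) → Path G (toℕ i)
  prefix {ℓ} p i = record
    { pvert = λ k → pvert p (inject≤ k (Fin.toℕ<n i))
    ; pdistinct = Fin.inject≤-injective _ _ _ _ ∘ pdistinct p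
    ; pstep = λ k → subst (λ k′ → Adjacent G (pvert p k′) (pvert p (suc (inject≤ k i≤ℓ))))
        (sym (inject≤-inject₁ k (Fin.toℕ<n i) i≤ℓ)) (pstep p (inject≤ k i≤ℓ)) }
    where
    i≤ℓ : toℕ i ≤ ℓ
    i≤ℓ = ℕ.≤-pred (Fin.toℕ<n i)

  end-prefix : ∀ {ℓ} (p : Path G ℓ) i → end (prefix p i) ≡ pvert p i
  end-prefix p i = cong (pvert p) (inject≤-fromℕ i (Fin.toℕ<n i))

  close-path : ∀ {ℓ} (p : Path G (2 + ℓ)) → Adjacent G (end p) (start p) → Cycle G ℓ
  close-path p e∼s = record
    { vert = pvert p ; distinct = pdistinct p ; step = pstep p ; close = e∼s }

  chord⇒onCycle : ∀ {ℓ} (p : Path G (suc ℓ)) (k : Fin ℓ) →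
    Adjacent G (start p) (pvert p (suc (suc k))) → OnCycle G (start p)
  chord⇒onCycle {ℓ} p k s∼p₂₊ₖ = toℕ k , close-path (prefix p i) e∼s , zero , refl
    where
    i : Fin (2 + ℓ)
    i = suc (suc k)
    e∼s : Adjacent G (end (prefix p i)) (start p)
    e∼s = subst (λ v → Adjacent G v (start p)) (sym (end-prefix p i)) (adjacent-sym G s∼p₂₊ₖ)

  -- Both neighbours of a saturated start lie on the path, and one of them is not its
  -- successor, so the edge to it closes a cycle.
  saturated⇒onCycle : ∀ {ℓ} (p : Path G ℓ) → StartSaturated p → TwoNeighbours G (start p) →
    OnCycle G (start p)
  saturated⇒onCycle p sat (twoNeighbours x y x≢y s∼x s∼y _ _) with sat x s∼x | sat y s∼y
  ... | zero , refl | _ = contradiction refl (adjacent⇒≢ G s∼x)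
  ... | _ | zero , refl = contradiction refl (adjacent⇒≢ G s∼y)
  ... | suc (suc k) , refl | _ = chord⇒onCycle p k s∼x
  ... | _ | suc (suc k) , refl = chord⇒onCycle p k s∼y
  ... | suc zero , refl | suc zero , refl = contradiction refl x≢y

  minDegree≥2⇒inCore : MinDegree≥2 G → ∀ v → InCyclesAndConnectingPaths G v
  minDegree≥2⇒inCore minDeg v =
    _ , q , saturated⇒onCycle q (Saturation.saturated s₂) (minDeg _) , end-onCycle , v∈q
    where
    -- Saturate the trivial path at v at one end, then at the other; both ends lie on cycles.
    s₁ : Saturation (trivialPath v)
    s₁ = saturate (trivialPath v)
    p₁ q₁ : Path G (Saturation.length s₁)
    p₁ = Saturation.path s₁
    q₁ = reverse p₁
    s₂ : Saturation q₁
    s₂ = saturate q₁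
    q : Path G (Saturation.length s₂)
    q = Saturation.path s₂
    v∈q : OnPath q v
    v∈q = Saturation.⊇ s₂ (reverse-⊇ p₁ (Saturation.⊇ s₁ (zero , refl)))
    end-saturated : StartSaturated (reverse q)
    end-saturated w e∼w = reverse-⊇ q (Saturation.⊇ s₂ (reverse-⊇ p₁ (Saturation.saturated s₁ w
      (subst (λ u → Adjacent G u w) (trans (Saturation.same-end s₂) (end-reverse p₁)) e∼w))))
    end-onCycle : OnCycle G (end q)
    end-onCycle = saturated⇒onCycle (reverse q) end-saturated (minDeg _)

-- Bicliques of a graph of girth at least five

module GirthFive (H : Graph) (girth≥5 : GirthAtLeast5 H) where

  private
    n : ℕ
    n = size H

  triangle-free : ∀ {a b c} → Adjacent H a b → Adjacent H b c → Adjacent H c a → ⊥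
  triangle-free {a} {b} {c} a∼b b∼c c∼a =
    contradiction (girth≥5 0 (close-path abc c∼a)) λ { (ℕ.s≤s (ℕ.s≤s (ℕ.s≤s ()))) }
    where
    bc : Path H 1
    bc = prepend (trivialPath c) b b∼c λ { (zero , c≡b) → adjacent⇒≢ H b∼c (sym c≡b) }
    abc : Path H 2
    abc = prepend bc a a∼b λ
      { (zero , b≡a) → adjacent⇒≢ H a∼b (sym b≡a)
      ; (suc zero , c≡a) → adjacent⇒≢ H c∼a c≡a }

  square-free : ∀ {a b c d} → Adjacent H a b → Adjacent H b c → Adjacent H c d → Adjacent H d a →
    a ≢ c → b ≢ d → ⊥
  square-free {a} {b} {c} {d} a∼b b∼c c∼d d∼a a≢c b≢d =
    contradiction (girth≥5 1 (close-path abcd d∼a)) λ { (ℕ.s≤s (ℕ.s≤s (ℕ.s≤s (ℕ.s≤s ())))) }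
    where
    cd : Path H 1
    cd = prepend (trivialPath d) c c∼d λ { (zero , d≡c) → adjacent⇒≢ H c∼d (sym d≡c) }
    bcd : Path H 2
    bcd = prepend cd b b∼c λ
      { (zero , c≡b) → adjacent⇒≢ H b∼c (sym c≡b)
      ; (suc zero , d≡b) → b≢d (sym d≡b) }
    abcd : Path H 3
    abcd = prepend bcd a a∼b λ
      { (zero , b≡a) → adjacent⇒≢ H a∼b (sym b≡a)
      ; (suc zero , c≡a) → a≢c (sym c≡a)
      ; (suc (suc zero) , d≡a) → adjacent⇒≢ H d∼a d≡a }

  N[_] : Fin n → Subset n
  N[ c ] = ⁅ c ⁆ ∪ Vec.tabulate (adj H c)

  ∈N⁺ : ∀ {c w} → w ≡ c ⊎ Adjacent H c w → w ∈ N[ c ]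
  ∈N⁺ {c} (inj₁ refl) = Subset.p⊆p∪q _ (Subset.x∈⁅x⁆ c)
  ∈N⁺ {c} {w} (inj₂ c∼w) = Subset.q⊆p∪q ⁅ c ⁆ _
    (Vec.lookup⇒[]= w _ (trans (Vec.lookup∘tabulate (adj H c) w) c∼w))

  ∈N⁻ : ∀ {c w} → w ∈ N[ c ] → w ≡ c ⊎ Adjacent H c w
  ∈N⁻ {c} {w} w∈N with Subset.x∈p∪q⁻ ⁅ c ⁆ _ w∈N
  ... | inj₁ w∈⁅c⁆ = inj₁ (Subset.x∈⁅y⁆⇒x≡y c w∈⁅c⁆)
  ... | inj₂ w∈nbhd = inj₂ (trans (sym (Vec.lookup∘tabulate (adj H c) w)) (Vec.[]=⇒lookup w∈nbhd))

  c∈N[c] : ∀ c → c ∈ N[ c ]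
  c∈N[c] c = ∈N⁺ (inj₁ refl)

  edge-in-N : ∀ {c u w} → u ∈ N[ c ] → w ∈ N[ c ] → Adjacent H u w → u ≡ c ⊎ w ≡ c
  edge-in-N u∈N w∈N u∼w with ∈N⁻ u∈N | ∈N⁻ w∈N
  ... | inj₁ u≡c | _ = inj₁ u≡c
  ... | _ | inj₁ w≡c = inj₂ w≡c
  ... | inj₂ c∼u | inj₂ c∼w = ⊥-elim (triangle-free c∼u u∼w (adjacent-sym H c∼w))

  share-edge⇔adjacent : ∀ {c d} → c ≢ d → ShareEdge H N[ c ] N[ d ] ⇔ Adjacent H c d
  share-edge⇔adjacent {c} {d} c≢d = mk⇔ shared⇒adjacent λ c∼d →
    c , d , c∈N[c] c , ∈N⁺ (inj₂ (adjacent-sym H c∼d)) , ∈N⁺ (inj₂ c∼d) , c∈N[c] d , c∼d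
    where
    shared⇒adjacent : ShareEdge H N[ c ] N[ d ] → Adjacent H c d
    shared⇒adjacent (u , w , u∈c , u∈d , w∈c , w∈d , u∼w)
      with edge-in-N u∈c w∈c u∼w | edge-in-N u∈d w∈d u∼w
    ... | inj₁ refl | inj₁ refl = contradiction refl c≢d
    ... | inj₁ refl | inj₂ refl = u∼w
    ... | inj₂ refl | inj₁ refl = adjacent-sym H u∼w
    ... | inj₂ refl | inj₂ refl = contradiction refl c≢d

  IsCentre : Subset n → Fin n → Set
  IsCentre S c = c ∈ S × S ⊆ N[ c ]

  private
    xor-≢ : ∀ {x y} → x ≢ y → x xor y ≡ true
    xor-≢ {true} {true} x≢y = contradiction refl x≢y
    xor-≢ {true} {false} _ = refl
    xor-≢ {false} {true} _ = refl
    xor-≢ {false} {false} x≢y = contradiction refl x≢y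

    module Bipartition {S X : Subset n}
        (bip : ∀ u w → u ∈ S → w ∈ S → adj H u w ≡ (Vec.lookup X u xor Vec.lookup X w)) where

      side : Fin n → Bool
      side = Vec.lookup X

      across : ∀ {u w} → u ∈ S → w ∈ S → side u ≢ side w → Adjacent H u w
      across u∈S w∈S u≁w = trans (bip _ _ u∈S w∈S) (xor-≢ u≁w)

      Crowded : Fin n → Set
      Crowded c = ∃ λ y → y ∈ S × side y ≡ side c × y ≢ c

      crowded? : ∀ c → Dec (Crowded c)
      crowded? c = Fin.any? λ y → (y ∈? S) ×-dec (side y Bool.≟ side c) ×-dec ¬? (y Fin.≟ c)

      alone⇒centre : ∀ {c} → c ∈ S → ¬ Crowded c → IsCentre S c
      alone⇒centre {c} c∈S alone = c∈S , λ {y} y∈S → ∈N⁺ (neighbour y∈S (side y Bool.≟ side c))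
        where
        neighbour : ∀ {y} → y ∈ S → Dec (side y ≡ side c) → y ≡ c ⊎ Adjacent H c y
        neighbour {y} y∈S (yes y~c) =
          inj₁ (decidable-stable (y Fin.≟ c) λ y≢c → alone (y , y∈S , y~c , y≢c))
        neighbour y∈S (no y≁c) = inj₂ (across c∈S y∈S (y≁c ∘ sym))

      -- Two vertices on each side would span a 4-cycle.
      not-both-crowded : ∀ {x v} → x ∈ S → v ∈ S → side x ≢ side v → Crowded x → Crowded v → ⊥
      not-both-crowded {x} {v} x∈S v∈S x≁v (s , s∈S , s~x , s≢x) (t , t∈S , t~v , t≢v) =
        square-free x∼v v∼s s∼t t∼x (s≢x ∘ sym) (t≢v ∘ sym)
        where
        x∼v : Adjacent H x v
        x∼v = across x∈S v∈S x≁v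
        v∼s : Adjacent H v s
        v∼s = across v∈S s∈S λ v~s → x≁v (trans (sym s~x) (sym v~s))
        s∼t : Adjacent H s t
        s∼t = across s∈S t∈S λ s~t → x≁v (trans (sym s~x) (trans s~t t~v))
        t∼x : Adjacent H t x
        t∼x = across t∈S x∈S λ t~x → x≁v (trans (sym t~x) t~v)

  icb⇒centre : ∀ {S} → InducesCompleteBipartite H S → ∃ (IsCentre S)
  icb⇒centre {S} (X , X⊆S , (x , x∈X) , (v , v∈S , v∉X) , bip) = centre (crowded? x) (crowded? v)
    where
    open Bipartition {S} {X} bip
    x≁v : side x ≢ side v
    x≁v x~v = v∉X (Vec.lookup⇒[]= v X (trans (sym x~v) (Vec.[]=⇒lookup x∈X)))
    centre : Dec (Crowded x) → Dec (Crowded v) → ∃ (IsCentre S)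
    centre (no x-alone) _ = x , alone⇒centre (X⊆S x∈X) x-alone
    centre _ (no v-alone) = v , alone⇒centre v∈S v-alone
    centre (yes crowdedˣ) (yes crowdedᵛ) =
      ⊥-elim (not-both-crowded (X⊆S x∈X) v∈S x≁v crowdedˣ crowdedᵛ)

  N-icb : ∀ {c a} → Adjacent H c a → InducesCompleteBipartite H N[ c ]
  N-icb {c} {a} c∼a =
    ⁅ c ⁆ , (λ w∈⁅c⁆ → ∈N⁺ (inj₁ (Subset.x∈⁅y⁆⇒x≡y c w∈⁅c⁆))) , (c , Subset.x∈⁅x⁆ c) ,
    (a , ∈N⁺ (inj₂ c∼a) , Subset.x≢y⇒x∉⁅y⁆ (adjacent⇒≢ H c∼a ∘ sym)) ,
    λ u w u∈N w∈N → bip (∈N⁻ u∈N) (∈N⁻ w∈N)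
    where
    side : Fin n → Bool
    side = Vec.lookup ⁅ c ⁆
    centre-side : side c ≡ true
    centre-side = Vec.[]=⇒lookup (Subset.x∈⁅x⁆ c)
    leaf-side : ∀ {w} → Adjacent H c w → side w ≡ false
    leaf-side c∼w = Bool.¬-not λ w∈⁅c⁆ →
      adjacent⇒≢ H c∼w (sym (Subset.x∈⁅y⁆⇒x≡y c (Vec.lookup⇒[]= _ ⁅ c ⁆ w∈⁅c⁆)))
    bip : ∀ {u w} → u ≡ c ⊎ Adjacent H c u → w ≡ c ⊎ Adjacent H c w →
      adj H u w ≡ (side u xor side w)
    bip (inj₁ refl) (inj₁ refl) = trans (adj-irrefl H c) (sym (Bool.xor-same (side c)))
    bip (inj₁ refl) (inj₂ c∼w) = trans c∼w (sym (cong₂ _xor_ centre-side (leaf-side c∼w)))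
    bip (inj₂ c∼u) (inj₁ refl) =
      trans (adjacent-sym H c∼u) (sym (cong₂ _xor_ (leaf-side c∼u) centre-side))
    bip {u} {w} (inj₂ c∼u) (inj₂ c∼w) = trans
      (Bool.¬-not λ u∼w → triangle-free c∼u u∼w (adjacent-sym H c∼w))
      (sym (cong₂ _xor_ (leaf-side c∼u) (leaf-side c∼w)))

  biclique⇒N : ∀ {S} → IsBiclique H S → ∃ λ c → S ≡ N[ c ] × ∃ (Adjacent H c)
  biclique⇒N {S} (icb@(X , X⊆S , (x , x∈X) , (v , v∈S , v∉X) , _) , maximal)
    with icb⇒centre icb
  ... | c , c∈S , S⊆N =
    c , Subset.⊆-antisym S⊆N (maximal N[ c ] S⊆N (N-icb (proj₂ neighbour))) , neighbour
    where
    neighbour : ∃ (Adjacent H c)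
    neighbour with ∈N⁻ (S⊆N (X⊆S x∈X)) | ∈N⁻ (S⊆N v∈S)
    ... | inj₂ c∼x | _ = x , c∼x
    ... | inj₁ _ | inj₂ c∼v = v , c∼v
    ... | inj₁ refl | inj₁ refl = contradiction x∈X v∉X

  twoNeighbours⇒N-biclique : ∀ {c} → TwoNeighbours H c → IsBiclique H N[ c ]
  twoNeighbours⇒N-biclique {c} (twoNeighbours a b a≢b c∼a c∼b _ _) = N-icb c∼a , maximal
    where
    maximal : ∀ T → N[ c ] ⊆ T → InducesCompleteBipartite H T → T ⊆ N[ c ]
    maximal T N⊆T icbT with icb⇒centre icbT
    ... | d , d∈T , T⊆N[d] with ∈N⁻ (T⊆N[d] (N⊆T (c∈N[c] c)))
    ...   | inj₁ refl = T⊆N[d]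
    ...   | inj₂ d∼c with ∈N⁻ (T⊆N[d] (N⊆T (∈N⁺ (inj₂ c∼a)))) | ∈N⁻ (T⊆N[d] (N⊆T (∈N⁺ (inj₂ c∼b))))
    ...     | inj₂ d∼a | _ = ⊥-elim (triangle-free d∼c c∼a (adjacent-sym H d∼a))
    ...     | _ | inj₂ d∼b = ⊥-elim (triangle-free d∼c c∼b (adjacent-sym H d∼b))
    ...     | inj₁ refl | inj₁ refl = contradiction refl a≢b

  N≡N⇒≡ : ∀ {u w} → TwoNeighbours H u → N[ u ] ≡ N[ w ] → w ≡ u
  N≡N⇒≡ {u} {w} (twoNeighbours a b a≢b u∼a u∼b _ _) N[u]≡N[w]
    with ∈N⁻ (subst (w ∈_) (sym N[u]≡N[w]) (c∈N[c] w))
  ... | inj₁ w≡u = w≡u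
  ... | inj₂ u∼w = ⊥-elim (other-neighbour (w Fin.≟ a))
    where
    triangle : ∀ {y} → y ≢ w → Adjacent H u y → ⊥
    triangle {y} y≢w u∼y with ∈N⁻ (subst (y ∈_) N[u]≡N[w] (∈N⁺ (inj₂ u∼y)))
    ... | inj₁ y≡w = y≢w y≡w
    ... | inj₂ w∼y = triangle-free u∼w w∼y (adjacent-sym H u∼y)
    other-neighbour : Dec (w ≡ a) → ⊥
    other-neighbour (yes refl) = triangle (a≢b ∘ sym) u∼b
    other-neighbour (no w≢a) = triangle (w≢a ∘ sym) u∼a

  leaf-biclique : ∀ {c w} → IsBiclique H N[ c ] → Adjacent H c w → ¬ TwoNeighbours H c →
    N[ c ] ≡ N[ w ]
  leaf-biclique {c} {w} (_ , maximal) c∼w leaf =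
    Subset.⊆-antisym N[c]⊆N[w] (maximal N[ w ] N[c]⊆N[w] (N-icb (adjacent-sym H c∼w)))
    where
    N[c]⊆N[w] : N[ c ] ⊆ N[ w ]
    N[c]⊆N[w] y∈N with ∈N⁻ y∈N
    ... | inj₁ refl = ∈N⁺ (inj₂ (adjacent-sym H c∼w))
    ... | inj₂ c∼y = ∈N⁺ (inj₁ (decidable-stable (_ Fin.≟ w) λ y≢w →
      leaf (twoNeighbours _ _ y≢w c∼y c∼w tt tt)))

-- The edge-biclique graph of a graph of girth at least five

lookup-injective : ∀ {A : Set} {xs : List A} → Unique xs → Injective _≡_ _≡_ (List.lookup xs)
lookup-injective (x∉xs AllPairs.∷ _) {zero} {zero} _ = refl
lookup-injective (x∉xs AllPairs.∷ _) {zero} {suc j} eq =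
  contradiction eq (All.lookup x∉xs (List.∈-lookup j))
lookup-injective (x∉xs AllPairs.∷ _) {suc i} {zero} eq =
  contradiction (sym eq) (All.lookup x∉xs (List.∈-lookup i))
lookup-injective (_ AllPairs.∷ unique) {suc i} {suc j} eq = cong suc (lookup-injective unique eq)

subsets-unique : ∀ m → Unique (subsets m)
subsets-unique zero = All.[] AllPairs.∷ AllPairs.[]
subsets-unique (suc m) = Unique.++⁺ (unique-with outside) (unique-with inside) disjoint
  where
  with-head : Bool → List (Subset (suc m))
  with-head b = List.map (b Vec.∷_) (subsets m)
  unique-with : ∀ b → Unique (with-head b)
  unique-with b = Unique.map⁺ (cong Vec.tail) (subsets-unique m)
  disjoint : ∀ {S} → ¬ (S List.∈ with-head outside × S List.∈ with-head inside)
  disjoint (S∈out , S∈in) with List.∈-map⁻ (outside Vec.∷_) S∈out | List.∈-map⁻ (inside Vec.∷_) S∈in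
  ... | _ , _ , refl | _ , _ , ()

∈subsets : ∀ {m} (S : Subset m) → S List.∈ subsets m
∈subsets Vec.[] = Any.here refl
∈subsets (false Vec.∷ S) = List.∈-++⁺ˡ (List.∈-map⁺ (outside Vec.∷_) (∈subsets S))
∈subsets (true Vec.∷ S) = List.∈-++⁺ʳ _ (List.∈-map⁺ (inside Vec.∷_) (∈subsets S))

module EdgeBicliques (H : Graph) (girth≥5 : GirthAtLeast5 H) where

  open GirthFive H girth≥5

  private
    B : Fin (size (KBe H)) → Subset (size H)
    B = List.lookup (bicliques H)

    B-biclique : ∀ i → IsBiclique H (B i)
    B-biclique i = proj₂ (List.∈-filter⁻ (biclique? H) {xs = subsets (size H)} (List.∈-lookup i))

    B-injective : Injective _≡_ _≡_ B
    B-injective = lookup-injective (Unique.filter⁺ (biclique? H) (subsets-unique (size H)))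

    B-surjective : ∀ {S} → IsBiclique H S → ∃ λ i → B i ≡ S
    B-surjective {S} S-biclique = Any.index S∈ , sym (Any.lookup-index S∈)
      where
      S∈ : S List.∈ bicliques H
      S∈ = List.∈-filter⁺ (biclique? H) (∈subsets S) S-biclique

  -- Abstract: unfolding these proof terms in later goals makes type checking impractically slow.
  abstract
    centre : Fin (size (KBe H)) → Fin (size H)
    centre i = proj₁ (biclique⇒N (B-biclique i))

    B≡N[centre] : ∀ i → B i ≡ N[ centre i ]
    B≡N[centre] i = proj₁ (proj₂ (biclique⇒N (B-biclique i)))

    centre-neighbour : ∀ i → ∃ (Adjacent H (centre i))
    centre-neighbour i = proj₂ (proj₂ (biclique⇒N (B-biclique i)))

  centre-injective : Injective _≡_ _≡_ centre
  centre-injective {i} {j} eq =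
    B-injective (trans (B≡N[centre] i) (trans (cong N[_] eq) (sym (B≡N[centre] j))))

  adj-centre : ∀ i j → adj (KBe H) i j ≡ adj H (centre i) (centre j)
  adj-centre i j = by-cases (i Fin.≟ j) (shareEdge? H (B i) (B j))
    where
    B≡N : ShareEdge H (B i) (B j) ≡ ShareEdge H N[ centre i ] N[ centre j ]
    B≡N = cong₂ (ShareEdge H) (B≡N[centre] i) (B≡N[centre] j)
    by-cases : (i? : Dec (i ≡ j)) (shared? : Dec (ShareEdge H (B i) (B j))) →
      (if ⌊ i? ⌋ then false else ⌊ shared? ⌋) ≡ adj H (centre i) (centre j)
    by-cases (yes refl) _ = sym (adj-irrefl H (centre i))
    by-cases (no i≢j) (yes shared) =
      sym (Equivalence.to (share-edge⇔adjacent (i≢j ∘ centre-injective)) (subst id B≡N shared))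
    by-cases (no i≢j) (no ¬shared) = sym (Bool.¬-not λ ci∼cj → ¬shared (subst id (sym B≡N)
      (Equivalence.from (share-edge⇔adjacent (i≢j ∘ centre-injective)) ci∼cj)))

  centreEmbedding : Embedding (KBe H) H
  centreEmbedding = record { to = centre ; injective = centre-injective ; adj-to = adj-centre }

  twoNeighbours⇒covered : ∀ {u} → TwoNeighbours H u → ∃ λ i → centre i ≡ u
  twoNeighbours⇒covered {u} deg₂ =
    let i , B≡N[u] = B-surjective (twoNeighbours⇒N-biclique deg₂)
    in i , N≡N⇒≡ deg₂ (trans (sym B≡N[u]) (B≡N[centre] i))

  -- Were centre i a leaf, its biclique would also be the biclique centred at its neighbour.
  surjective⇒minDegree≥2 : (∀ u → ∃ λ i → centre i ≡ u) → MinDegree≥2 H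
  surjective⇒minDegree≥2 onto u =
    subst (TwoNeighbours H) (proj₂ (onto u)) (centre-twoNeighbours (proj₁ (onto u)))
    where
    centre-twoNeighbours : ∀ i → TwoNeighbours H (centre i)
    centre-twoNeighbours i = decidable-stable (twoNeighbours? H (centre i)) λ leaf →
      let w , c∼w = centre-neighbour i
          j , cj≡w = onto w
          i≡j : i ≡ j
          i≡j = B-injective (begin
            B i           ≡⟨ B≡N[centre] i ⟩
            N[ centre i ] ≡⟨ leaf-biclique N[centre]-biclique c∼w leaf ⟩
            N[ w ]        ≡⟨ cong N[_] cj≡w ⟨
            N[ centre j ] ≡⟨ B≡N[centre] j ⟨
            B j           ∎)
      in adjacent⇒≢ H c∼w (trans (cong centre i≡j) cj≡w)
      where
      open ≡-Reasoning
      N[centre]-biclique : IsBiclique H N[ centre i ]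
      N[centre]-biclique = subst (IsBiclique H) (B≡N[centre] i) (B-biclique i)

-- Iterating the edge-biclique operator

antitone-stabilises : (s : ℕ → ℕ) → (∀ k → s (suc k) ≤ s k) → ∃ λ k → s (suc k) ≡ s k
antitone-stabilises s antitone = go (s 0) 0 ℕ.≤-refl
  where
  go : ∀ bound k → s k ≤ bound → ∃ λ k → s (suc k) ≡ s k
  go bound k sₖ≤bound with s (suc k) ℕ.≟ s k
  ... | yes eq = k , eq
  go zero k sₖ≤0 | no neq =
    contradiction (trans (ℕ.n≤0⇒n≡0 (ℕ.≤-trans (antitone k) sₖ≤0)) (sym (ℕ.n≤0⇒n≡0 sₖ≤0))) neq
  go (suc bound) k sₖ≤1+bound | no neq =
    go bound (suc k) (ℕ.≤-pred (ℕ.≤-trans (ℕ.≤∧≢⇒< (antitone k) neq) sₖ≤1+bound))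

injective⇒surjective : ∀ {m n} → m ≡ n → (f : Fin m → Fin n) → Injective _≡_ _≡_ f →
  ∀ y → ∃ λ x → f x ≡ y
injective⇒surjective {suc m} refl f injective y =
  decidable-stable (Fin.any? λ x → f x Fin.≟ y) λ y∉image →
    let y≢f : ∀ x → y ≢ f x
        y≢f x = y∉image ∘ (x ,_) ∘ sym
        f′ : Fin (suc m) → Fin m
        f′ x = punchOut (y≢f x)
    in ℕ.1+n≰n (Fin.injective⇒≤ {f = f′} λ {x} {x′} →
         injective ∘ Fin.punchOut-injective (y≢f x) (y≢f x′))

KBe-girth≥5 : ∀ {H} → GirthAtLeast5 H → GirthAtLeast5 (KBe H)
KBe-girth≥5 girth≥5 = Embedding.girth≥5 (EdgeBicliques.centreEmbedding _ girth≥5) girth≥5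

module Iterates (G : Graph) (girth≥5 : GirthAtLeast5 G) where

  girth≥5-KBe^ : ∀ k → GirthAtLeast5 (KBe^ k G)
  girth≥5-KBe^ zero = girth≥5
  girth≥5-KBe^ (suc k) = KBe-girth≥5 (girth≥5-KBe^ k)

  module Step k = EdgeBicliques (KBe^ k G) (girth≥5-KBe^ k)

  embedding : ∀ k → Embedding (KBe^ k G) G
  embedding zero = idₑ G
  embedding (suc k) = embedding k ∘ₑ Step.centreEmbedding k

  core-covered : ∀ k {w} → InCyclesAndConnectingPaths G w → Covers (embedding k) w
  core-covered zero {w} _ = w , refl
  core-covered (suc k) w∈core =
    let u , u↦w = core-covered k w∈core
        deg₂ : TwoNeighbours (KBe^ k G) u
        deg₂ = Embedding.twoNeighbours-reflect (embedding k) (core-covered k)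
                 (subst (TwoNeighboursIn G _) (sym u↦w) (inCore-twoNeighbours w∈core))
        i , i↦u = Step.twoNeighbours⇒covered k deg₂
    in i , trans (cong (to (embedding k)) i↦u) u↦w

  stabilisation : ∃ λ k → size (KBe^ (suc k) G) ≡ size (KBe^ k G)
  stabilisation = antitone-stabilises (λ k → size (KBe^ k G))
    λ k → Fin.injective⇒≤ (Step.centre-injective k)

  k₀ : ℕ
  k₀ = proj₁ stabilisation

  minDegree≥2 : ∀ {k} → k₀ ≤′ k → MinDegree≥2 (KBe^ k G)
  minDegree≥2 ≤′-refl = Step.surjective⇒minDegree≥2 k₀
    (injective⇒surjective (proj₂ stabilisation) (Step.centre k₀) (Step.centre-injective k₀))
  minDegree≥2 (≤′-step {k} k₀≤′k) u = Embedding.twoNeighbours-reflect (Step.centreEmbedding k)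
    (λ {w} _ → Step.twoNeighbours⇒covered k (minDegree≥2 k₀≤′k w))
    (minDegree≥2 k₀≤′k (Step.centre k u))

  converges : ∀ {k} → k₀ ≤′ k → IsoToInduced (KBe^ k G) G (InCyclesAndConnectingPaths G)
  converges {k} k₀≤′k = to h , Embedding.injective h , Embedding.adj-to h ,
    λ w → mk⇔ (core-covered k) λ (u , u↦w) →
      subst (InCyclesAndConnectingPaths G) u↦w
        (Embedding.inCore h (minDegree≥2⇒inCore (minDegree≥2 k₀≤′k) u))
    where
    h : Embedding (KBe^ k G) G
    h = embedding k

theorem2 : (G : Graph) → GirthAtLeast5 G →
    ConvergesToInduced G (InCyclesAndConnectingPaths G)
theorem2 G girth≥5 = k₀ , λ k k₀≤k → converges (ℕ.≤⇒≤′ k₀≤k)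
  where open Iterates G girth≥5
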